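{- In a semilattice, for any objects $x$ and $y$, $N(xy)=N(x)\cup N(y)$.
   Context: A semilattice here is a commutative monoid (written multiplicatively, with identity) in which every element $x$ satisfies $x^2=x$. Write $x\mid y$ if $xz=y$ for some $z$. An object $s$ is singular if it has a single successor, i.e. there is an object $t\neq s$ with $s\mid t$ such that for every $x$, if $s\mid x$ then $x=s$ or $t\mid x$. For an object $x$, $N(x)$ is the set of singular objects $s$ with $x\nmid s$. -}

module Defs where

open import Level using (Level; _⊔_; suc)
open import Algebra.Bundles using (CommutativeMonoid)
open import Data.Product using (Σ; ∃; _×_; _,_)
open import Data.Sum using (_⊎_)
open import Relation.Nullary using (¬_)

record Semilattice (c ℓ : Level) : Set (suc (c ⊔ ℓ)) where
  field
    commutativeMonoid : CommutativeMonoid c ℓ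
  open CommutativeMonoid commutativeMonoid public
  field
    idem : ∀ x → (x ∙ x) ≈ x

module SemilatticeDefs {c ℓ : Level} (S : Semilattice c ℓ) where
  open Semilattice S

  _∣_ : Carrier → Carrier → Set (c ⊔ ℓ)
  x ∣ y = ∃ λ z → (x ∙ z) ≈ y

  Singular : Carrier → Set (c ⊔ ℓ)
  Singular s = ∃ λ t → ¬ (t ≈ s) × (s ∣ t) ×
                 (∀ x → s ∣ x → (x ≈ s) ⊎ (t ∣ x))

  N : Carrier → Carrier → Set (c ⊔ ℓ)
  N x s = Singular s × ¬ (x ∣ s)

-- For a singular s with successor t, every x satisfies either x s = s (so
-- x ∣ s) or t ∣ x s (so x ∤ s, as t ∤ s); hence divisibility into s is
-- decidable. Since x y ∣ s exactly when x ∣ s and y ∣ s, deciding x ∣ s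
-- splits ¬ (x y ∣ s) into ¬ (x ∣ s) or ¬ (y ∣ s).
module Submission where

open import Defs
open import Level using (Level)
open import Data.Sum using (_⊎_; inj₁; inj₂; [_,_])
open import Data.Product using (_×_; _,_)
open import Relation.Nullary using (Dec; yes; no)
import Relation.Binary.Reasoning.Setoid as SetoidReasoning

module Properties {c ℓ : Level} (S : Semilattice c ℓ) where
  open Semilattice S
  open SemilatticeDefs S
  open SetoidReasoning setoid

  ∣-respʳ-≈ : ∀ {x y z} → x ∣ y → y ≈ z → x ∣ z
  ∣-respʳ-≈ (q , xq≈y) y≈z = q , trans xq≈y y≈z

  ∣-trans : ∀ {x y z} → x ∣ y → y ∣ z → x ∣ z
  ∣-trans {x} {y} {z} (a , xa≈y) (b , yb≈z) = a ∙ b , (begin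
    x ∙ (a ∙ b)  ≈⟨ assoc x a b ⟨
    (x ∙ a) ∙ b  ≈⟨ ∙-congʳ xa≈y ⟩
    y ∙ b        ≈⟨ yb≈z ⟩
    z            ∎)

  x∣xy : ∀ x y → x ∣ (x ∙ y)
  x∣xy x y = y , refl

  y∣xy : ∀ x y → y ∣ (x ∙ y)
  y∣xy x y = x , comm y x

  x∣y⇒xy≈y : ∀ {x y} → x ∣ y → (x ∙ y) ≈ y
  x∣y⇒xy≈y {x} {y} (q , xq≈y) = begin
    x ∙ y        ≈⟨ ∙-congˡ xq≈y ⟨
    x ∙ (x ∙ q)  ≈⟨ assoc x x q ⟨
    (x ∙ x) ∙ q  ≈⟨ ∙-congʳ (idem x) ⟩
    x ∙ q        ≈⟨ xq≈y ⟩
    y            ∎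

  ∣-antisym : ∀ {x y} → x ∣ y → y ∣ x → x ≈ y
  ∣-antisym {x} {y} x∣y y∣x = begin
    x      ≈⟨ x∣y⇒xy≈y y∣x ⟨
    y ∙ x  ≈⟨ comm y x ⟩
    x ∙ y  ≈⟨ x∣y⇒xy≈y x∣y ⟩
    y      ∎

  x∣z∧y∣z⇒xy∣z : ∀ {x y z} → x ∣ z → y ∣ z → (x ∙ y) ∣ z
  x∣z∧y∣z⇒xy∣z {x} {y} {z} x∣z y∣z = z , (begin
    (x ∙ y) ∙ z  ≈⟨ assoc x y z ⟩
    x ∙ (y ∙ z)  ≈⟨ ∙-congˡ (x∣y⇒xy≈y y∣z) ⟩
    x ∙ z        ≈⟨ x∣y⇒xy≈y x∣z ⟩
    z            ∎)

  singular⇒∣-dec : ∀ {s} → Singular s → ∀ x → Dec (x ∣ s)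
  singular⇒∣-dec {s} (t , t≉s , s∣t , successor) x with successor (x ∙ s) (y∣xy x s)
  ... | inj₁ xs≈s = yes (s , xs≈s)
  ... | inj₂ t∣xs = no λ x∣s → t≉s (∣-antisym (∣-respʳ-≈ t∣xs (x∣y⇒xy≈y x∣s)) s∣t)

  N-∙⁻ : ∀ x y {s} → N (x ∙ y) s → N x s ⊎ N y s
  N-∙⁻ x y (sing , xy∤s) with singular⇒∣-dec sing x
  ... | yes x∣s = inj₂ (sing , λ y∣s → xy∤s (x∣z∧y∣z⇒xy∣z x∣s y∣s))
  ... | no  x∤s = inj₁ (sing , x∤s)

  N-∙⁺ : ∀ x y {s} → N x s ⊎ N y s → N (x ∙ y) s
  N-∙⁺ x y = [ (λ (sing , x∤s) → sing , λ xy∣s → x∤s (∣-trans (x∣xy x y) xy∣s))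
             , (λ (sing , y∤s) → sing , λ xy∣s → y∤s (∣-trans (y∣xy x y) xy∣s))
             ]

mainTheorem9 : ∀ {c ℓ : Level} (S : Semilattice c ℓ) →
    let open Semilattice S in
    let open SemilatticeDefs S in
    ∀ x y s → (N (x ∙ y) s → N x s ⊎ N y s) × (N x s ⊎ N y s → N (x ∙ y) s)
mainTheorem9 S x y s = N-∙⁻ x y , N-∙⁺ x y
  where open Properties S
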